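{- Let $A=(A,\wedge,\vee,\cdot,\to,1)$ be an algebra of type $(2,2,2,2,0)$ satisfying, for all $a,b,c\in A$: (1) $(A,\wedge,\vee)$ is a distributive lattice; (2) $1$ is the largest element; (3) $(A,\cdot,1)$ is a commutative monoid; (4) $(a\to b)\wedge(a\to c)=a\to(b\wedge c)$; (5) $(a\to c)\wedge(b\to c)=(a\vee b)\to c$; (6) $a\to a=1$; (7) $(a\vee b)\cdot c=(a\cdot c)\vee(b\cdot c)$; (8) $(a\to b)\cdot(b\to c)\le a\to c$. Then the following are equivalent: (i) for all $a,b,c\in A$, $a\to b\le (a\cdot c)\to(b\cdot c)$; (ii) for all $a,b,c,d\in A$, $(a\to b)\cdot(c\to d)\le (a\cdot c)\to(b\cdot d)$. -}

module Defs where

open import Level using (Level; suc; _⊔_)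
open import Relation.Binary.Core using (Rel)
open import Algebra.Core using (Op₂)
open import Algebra.Definitions using (Congruent₂)
open import Algebra.Structures using (IsCommutativeMonoid)
open import Algebra.Lattice.Structures using (IsDistributiveLattice)

record Alg (c ℓ : Level) : Set (suc (c ⊔ ℓ)) where
  infixr 5 _⇒_
  infixl 7 _·_
  infixr 6 _∨_
  infixr 7 _∧_
  infix 4 _≈_ _≤_
  field
    Carrier : Set c
    _≈_     : Rel Carrier ℓ
    _∧_     : Op₂ Carrier
    _∨_     : Op₂ Carrier
    _·_     : Op₂ Carrier
    _⇒_     : Op₂ Carrier
    1#      : Carrier

  _≤_ : Rel Carrier ℓ
  a ≤ b = (a ∧ b) ≈ a

  field
    isDistributiveLattice : IsDistributiveLattice _≈_ _∨_ _∧_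
    top : ∀ a → a ≤ 1#
    isCommutativeMonoid : IsCommutativeMonoid _≈_ _·_ 1#
    -- ≈ is the equality of the algebra, so → must respect it
    -- (∧, ∨, · already do, via the lattice/monoid structures)
    ⇒-cong : Congruent₂ _≈_ _⇒_
    ⇒-∧ʳ : ∀ a b c → ((a ⇒ b) ∧ (a ⇒ c)) ≈ (a ⇒ (b ∧ c))
    ⇒-∨ˡ : ∀ a b c → ((a ⇒ c) ∧ (b ⇒ c)) ≈ ((a ∨ b) ⇒ c)
    ⇒-refl : ∀ a → (a ⇒ a) ≈ 1#
    ·-distribʳ-∨ : ∀ a b c → ((a ∨ b) · c) ≈ ((a · c) ∨ (b · c))
    ⇒-trans : ∀ a b c → ((a ⇒ b) · (b ⇒ c)) ≤ (a ⇒ c)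

CondI : ∀ {c ℓ} → Alg c ℓ → Set (c ⊔ ℓ)
CondI A = ∀ a b c → (a ⇒ b) ≤ ((a · c) ⇒ (b · c))
  where open Alg A

CondII : ∀ {c ℓ} → Alg c ℓ → Set (c ⊔ ℓ)
CondII A = ∀ a b c d → ((a ⇒ b) · (c ⇒ d)) ≤ ((a · c) ⇒ (b · d))
  where open Alg A

-- Multiplication is monotone in the lattice order, because it distributes
-- over joins (7).  Given (i), both factors of (a ⇒ b) · (c ⇒ d) can be
-- enlarged to (a · c ⇒ b · c) · (b · c ⇒ b · d), which transitivity (8)
-- bounds by a · c ⇒ b · d.  Conversely, (ii) with c = d gives (i), since
-- c ⇒ c = 1 is the unit of ·.
module Submission where

open import Defs
open import Level using (Level)
open import Data.Product using (_×_; _,_)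
open import Algebra.Structures using (IsCommutativeMonoid)
open import Algebra.Lattice.Structures using (IsDistributiveLattice)
import Relation.Binary.Reasoning.Setoid as SetoidReasoning

module Properties {c ℓ : Level} (A : Alg c ℓ) where
  open Alg A
  open IsDistributiveLattice isDistributiveLattice
  open IsCommutativeMonoid isCommutativeMonoid using ()
    renaming (setoid to ≈-setoid; comm to ·-comm; ∙-cong to ·-cong; identityʳ to ·-identityʳ)
  open SetoidReasoning ≈-setoid

  ≤-trans : ∀ {a b d} → a ≤ b → b ≤ d → a ≤ d
  ≤-trans {a} {b} {d} a≤b b≤d = begin
    a ∧ d        ≈⟨ ∧-congʳ (sym a≤b) ⟩
    (a ∧ b) ∧ d  ≈⟨ ∧-assoc a b d ⟩
    a ∧ (b ∧ d)  ≈⟨ ∧-congˡ b≤d ⟩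
    a ∧ b        ≈⟨ a≤b ⟩
    a            ∎

  ≤-respʳ-≈ : ∀ {a b b′} → b ≈ b′ → a ≤ b → a ≤ b′
  ≤-respʳ-≈ b≈b′ a≤b = trans (∧-congˡ (sym b≈b′)) a≤b

  ≤-respˡ-≈ : ∀ {a a′ b} → a ≈ a′ → a ≤ b → a′ ≤ b
  ≤-respˡ-≈ a≈a′ a≤b = trans (∧-congʳ (sym a≈a′)) (trans a≤b a≈a′)

  x≤x∨y : ∀ x y → x ≤ x ∨ y
  x≤x∨y = ∧-absorbs-∨

  ≤⇒∨≈ : ∀ {a b} → a ≤ b → a ∨ b ≈ b
  ≤⇒∨≈ {a} {b} a≤b = begin
    a ∨ b        ≈⟨ ∨-congʳ (sym a≤b) ⟩
    (a ∧ b) ∨ b  ≈⟨ ∨-comm (a ∧ b) b ⟩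
    b ∨ (a ∧ b)  ≈⟨ ∨-congˡ (∧-comm a b) ⟩
    b ∨ (b ∧ a)  ≈⟨ ∨-absorbs-∧ b a ⟩
    b            ∎

  ·-monoˡ-≤ : ∀ {a b} d → a ≤ b → a · d ≤ b · d
  ·-monoˡ-≤ {a} {b} d a≤b = ≤-respʳ-≈ b·d≈a·d∨b·d (x≤x∨y (a · d) (b · d))
    where
    b·d≈a·d∨b·d : (a · d) ∨ (b · d) ≈ b · d
    b·d≈a·d∨b·d = trans (sym (·-distribʳ-∨ a b d)) (·-cong (≤⇒∨≈ a≤b) refl)

  ·-monoʳ-≤ : ∀ {a b} d → a ≤ b → d · a ≤ d · b
  ·-monoʳ-≤ {a} {b} d a≤b =
    ≤-respˡ-≈ (·-comm a d) (≤-respʳ-≈ (·-comm b d) (·-monoˡ-≤ d a≤b))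

  ·-mono-≤ : ∀ {a b x y} → a ≤ b → x ≤ y → a · x ≤ b · y
  ·-mono-≤ {b = b} {x} a≤b x≤y = ≤-trans (·-monoˡ-≤ x a≤b) (·-monoʳ-≤ b x≤y)

  condI⇒condII : CondI A → CondII A
  condI⇒condII condI a b x d =
    ≤-trans (·-mono-≤ (condI a b x) x⇒d≤bx⇒bd) (⇒-trans (a · x) (b · x) (b · d))
    where
    x⇒d≤bx⇒bd : x ⇒ d ≤ (b · x) ⇒ (b · d)
    x⇒d≤bx⇒bd = ≤-respʳ-≈ (⇒-cong (·-comm x b) (·-comm d b)) (condI x d b)

  condII⇒condI : CondII A → CondI A
  condII⇒condI condII a b x = ≤-respˡ-≈ a⇒b·x⇒x≈a⇒b (condII a b x x)
    where
    a⇒b·x⇒x≈a⇒b : (a ⇒ b) · (x ⇒ x) ≈ a ⇒ b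
    a⇒b·x⇒x≈a⇒b = trans (·-cong refl (⇒-refl x)) (·-identityʳ (a ⇒ b))

lemma2p7 : ∀ {c ℓ : Level} (A : Alg c ℓ) → (CondI A → CondII A) × (CondII A → CondI A)
lemma2p7 A = condI⇒condII , condII⇒condI
  where open Properties A
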